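{- The function $g$ from the non-negative integers to the non-negative integers is injective.
   Context: For a non-negative integer $n$, $g(n)$ is the least integer $k$ such that there exists a strictly increasing sequence of integers $n = a_1 < a_2 < \cdots < a_t = k$ ($t \geq 1$) whose product $a_1 a_2 \cdots a_t$ is a perfect square. -}

module Defs where

open import Data.Nat using (ℕ; _*_; _<_; _≤_)
open import Data.List using (List; []; _∷_; last)
open import Data.Nat.ListAction using (product)
open import Data.List.Relation.Unary.Linked using (Linked)
open import Data.Maybe using (just)
open import Data.Product using (∃; _×_)
open import Relation.Binary.PropositionalEquality using (_≡_)

IsSquare : ℕ → Set
IsSquare m = ∃ λ r → m ≡ r * r

Admissible : ℕ → ℕ → Set
Admissible n k = ∃ λ (as : List ℕ) →
  Linked _<_ (n ∷ as) × last (n ∷ as) ≡ just k × IsSquare (product (n ∷ as))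

-- g n ≡ k : k is the least integer admissible for n
IsG : ℕ → ℕ → Set
IsG n k = Admissible n k × (∀ k′ → Admissible n k′ → k ≤ k′)

-- If g m = g n = k with 0 < m < n, let A and B be witnessing sequences from m and from n
-- to k. Their symmetric difference A ⊖ B is strictly increasing, starts at m and loses the
-- common endpoint k, so it ends at some k′ < k; and prod A · prod B = prod (A ⊖ B) · I²
-- with I the product of the common terms, so prod (A ⊖ B) is a square as well. Hence
-- k′ is admissible for m, against the minimality of k. For m = 0 instead, g 0 = 0 while
-- every k admissible for n satisfies n ≤ k.
module Submission where

open import Defs
open import Data.Nat
open import Data.Nat.Properties
open import Data.Nat.Divisibility using (_∣_; divides; ∣-refl)
open import Data.Nat.DivMod using (_/_; m/n*n≡m)
open import Data.Nat.GCD using (gcd; gcd[m,n]∣m; gcd[m,n]∣n; gcd[m,n]≢0)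
open import Data.Nat.Coprimality using (Coprime; coprime-/gcd; coprime-divisor)
open import Data.Nat.ListAction using (product)
open import Data.Nat.ListAction.Properties using (product≢0)
open import Data.Nat.Solver using (module +-*-Solver)
open import Data.List using (List; []; _∷_; _++_; [_]; foldr; last)
open import Data.List.Properties using (foldr-++)
open import Data.List.Relation.Unary.All as All using (All; []; _∷_)
open import Data.List.Relation.Unary.Linked using (Linked; []; [-]; _∷_)
open import Data.List.Relation.Unary.Linked.Properties using (Linked⇒All)
open import Data.Maybe using (just)
open import Data.Product using (∃; _×_; _,_; proj₁)
open import Data.Sum using (inj₁)
open import Relation.Binary using (tri<; tri≈; tri>)
open import Relation.Binary.PropositionalEquality hiding ([_])
open import Relation.Nullary using (¬_; contradiction)
open import Relation.Unary using (Pred)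

open +-*-Solver

coprime-square-cancel : ∀ {S c t} → Coprime c t → S * (c * c) ≡ t * t → c ≡ 1
coprime-square-cancel {S} {c} {t} c⊥t eq = c⊥t (∣-refl , coprime-divisor c⊥t c∣t*t)
  where
  c∣t*t : c ∣ t * t
  c∣t*t = divides (S * c) (trans (sym eq) (solve 2 (λ S c → S :* (c :* c) := (S :* c) :* c) refl S c))

square-cancel : ∀ S c .{{_ : NonZero c}} → IsSquare (S * (c * c)) → IsSquare S
square-cancel S c (t , eq) = t′ , S≡t′*t′
  where
  d = gcd c t
  instance
    d≢0 : NonZero d
    d≢0 = ≢-nonZero (gcd[m,n]≢0 c t (inj₁ (≢-nonZero⁻¹ c)))
    d*d≢0 : NonZero (d * d)
    d*d≢0 = m*n≢0 d d
  c′ = c / d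
  t′ = t / d
  open ≡-Reasoning
  scaled : S * (c′ * c′) * (d * d) ≡ t′ * t′ * (d * d)
  scaled = begin
    S * (c′ * c′) * (d * d)    ≡⟨ solve 3 (λ S c d → S :* (c :* c) :* (d :* d) := S :* ((c :* d) :* (c :* d))) refl S c′ d ⟩
    S * (c′ * d * (c′ * d))    ≡⟨ cong (λ z → S * (z * z)) (m/n*n≡m (gcd[m,n]∣m c t)) ⟩
    S * (c * c)                ≡⟨ eq ⟩
    t * t                      ≡⟨ cong (λ z → z * z) (m/n*n≡m (gcd[m,n]∣n c t)) ⟨
    t′ * d * (t′ * d)          ≡⟨ solve 2 (λ t d → (t :* d) :* (t :* d) := t :* t :* (d :* d)) refl t′ d ⟩
    t′ * t′ * (d * d)          ∎
  reduced : S * (c′ * c′) ≡ t′ * t′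
  reduced = *-cancelʳ-≡ _ _ (d * d) scaled
  S≡t′*t′ : S ≡ t′ * t′
  S≡t′*t′ = begin
    S              ≡⟨ *-identityʳ S ⟨
    S * (1 * 1)    ≡⟨ cong (λ z → S * (z * z)) (coprime-square-cancel {S} (coprime-/gcd c t) reduced) ⟨
    S * (c′ * c′)  ≡⟨ reduced ⟩
    t′ * t′        ∎

square-factor-nonZero : ∀ {a} P I .{{_ : NonZero a}} → a ≡ P * (I * I) → NonZero I
square-factor-nonZero {a} P zero eq = contradiction (trans eq (*-zeroʳ P)) (≢-nonZero⁻¹ a)
square-factor-nonZero P (suc _) _ = _

-- On strictly increasing lists, toggle x inserts x if it is absent and deletes it if
-- present, so xs ⊖ ys is the symmetric difference of the underlying sets.
toggle : ℕ → List ℕ → List ℕ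
toggle x [] = [ x ]
toggle x (y ∷ ys) with <-cmp x y
... | tri< _ _ _ = x ∷ y ∷ ys
... | tri≈ _ _ _ = ys
... | tri> _ _ _ = y ∷ toggle x ys

infixl 6 _⊖_
_⊖_ : List ℕ → List ℕ → List ℕ
xs ⊖ ys = foldr toggle ys xs

product-toggle : ∀ x ys → ∃ λ I → x * product ys ≡ product (toggle x ys) * (I * I)
product-toggle x [] = 1 , solve 1 (λ x → x :* con 1 := x :* con 1 :* (con 1 :* con 1)) refl x
product-toggle x (y ∷ ys) with <-cmp x y
... | tri< _ _ _ = 1 , sym (*-identityʳ _)
... | tri≈ _ refl _ = x , solve 2 (λ x P → x :* (x :* P) := P :* (x :* x)) refl x (product ys)
... | tri> _ _ _ with product-toggle x ys
...   | I , eq = I , (begin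
  x * (y * product ys)                  ≡⟨ solve 3 (λ x y P → x :* (y :* P) := y :* (x :* P)) refl x y (product ys) ⟩
  y * (x * product ys)                  ≡⟨ cong (y *_) eq ⟩
  y * (product (toggle x ys) * (I * I)) ≡⟨ *-assoc y _ _ ⟨
  y * product (toggle x ys) * (I * I)   ∎)
  where open ≡-Reasoning

product-⊖ : ∀ xs ys → ∃ λ I → product xs * product ys ≡ product (xs ⊖ ys) * (I * I)
product-⊖ [] ys = 1 , solve 1 (λ P → con 1 :* P := P :* (con 1 :* con 1)) refl (product ys)
product-⊖ (x ∷ xs) ys with product-⊖ xs ys | product-toggle x (xs ⊖ ys)
... | J , eqJ | I , eqI = I * J , (begin
  x * product xs * product ys     ≡⟨ *-assoc x _ _ ⟩
  x * (product xs * product ys)   ≡⟨ cong (x *_) eqJ ⟩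
  x * (R * (J * J))               ≡⟨ *-assoc x R _ ⟨
  x * R * (J * J)                 ≡⟨ cong (_* (J * J)) eqI ⟩
  T * (I * I) * (J * J)           ≡⟨ solve 3 (λ T I J → T :* (I :* I) :* (J :* J) := T :* ((I :* J) :* (I :* J))) refl T I J ⟩
  T * (I * J * (I * J))           ∎)
  where
  open ≡-Reasoning
  R = product (xs ⊖ ys)
  T = product (toggle x (xs ⊖ ys))

linked-skip : ∀ {b y ys} → Linked _<_ (b ∷ y ∷ ys) → Linked _<_ (b ∷ ys)
linked-skip {ys = []} _ = [-]
linked-skip {ys = _ ∷ _} (b<y ∷ y<z ∷ l) = <-trans b<y y<z ∷ l

toggle-linked : ∀ {b x ys} → b < x → Linked _<_ (b ∷ ys) → Linked _<_ (b ∷ toggle x ys)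
toggle-linked {ys = []} b<x _ = b<x ∷ [-]
toggle-linked {x = x} {y ∷ ys} b<x l@(b<y ∷ ly) with <-cmp x y
... | tri< x<y _ _ = b<x ∷ x<y ∷ ly
... | tri≈ _ _ _ = linked-skip l
... | tri> _ _ y<x = b<y ∷ toggle-linked y<x ly

⊖-linked : ∀ {b} xs ys → Linked _<_ (b ∷ xs) → Linked _<_ (b ∷ ys) → Linked _<_ (b ∷ xs ⊖ ys)
⊖-linked [] ys _ ly = ly
⊖-linked (x ∷ xs) ys lx@(b<x ∷ _) ly = toggle-linked b<x (⊖-linked xs ys (linked-skip lx) ly)

toggle-head : ∀ {x} ys → Linked _<_ (x ∷ ys) → toggle x ys ≡ x ∷ ys
toggle-head [] _ = refl
toggle-head {x} (y ∷ ys) (x<y ∷ _) with <-cmp x y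
... | tri< _ _ _ = refl
... | tri≈ x≮y _ _ = contradiction x<y x≮y
... | tri> x≮y _ _ = contradiction x<y x≮y

⊖-head : ∀ {x y} xs ys → x < y → Linked _<_ (x ∷ xs) → Linked _<_ (y ∷ ys) →
         (x ∷ xs) ⊖ (y ∷ ys) ≡ x ∷ (xs ⊖ (y ∷ ys))
⊖-head xs ys x<y lx ly = toggle-head (xs ⊖ (_ ∷ ys)) (⊖-linked xs (_ ∷ ys) lx (x<y ∷ ly))

toggle-all : ∀ {p} {P : Pred ℕ p} {x ys} → P x → All P ys → All P (toggle x ys)
toggle-all {ys = []} px [] = px ∷ []
toggle-all {x = x} {y ∷ ys} px (py ∷ pys) with <-cmp x y
... | tri< _ _ _ = px ∷ py ∷ pys
... | tri≈ _ _ _ = pys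
... | tri> _ _ _ = py ∷ toggle-all px pys

⊖-all : ∀ {p} {P : Pred ℕ p} {xs ys} → All P xs → All P ys → All P (xs ⊖ ys)
⊖-all [] pys = pys
⊖-all (px ∷ pxs) pys = toggle-all px (⊖-all pxs pys)

toggle-max : ∀ {k} ys → All (_< k) ys → toggle k (ys ++ [ k ]) ≡ ys
toggle-max {k} [] [] with <-cmp k k
... | tri< k<k _ _ = contradiction k<k (<-irrefl refl)
... | tri≈ _ _ _ = refl
... | tri> _ _ k<k = contradiction k<k (<-irrefl refl)
toggle-max {k} (y ∷ ys) (y<k ∷ ys<k) with <-cmp k y
... | tri< k<y _ _ = contradiction k<y (<⇒≯ y<k)
... | tri≈ _ k≡y _ = contradiction (sym k≡y) (<⇒≢ y<k)
... | tri> _ _ _ = cong (y ∷_) (toggle-max ys ys<k)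

⊖-cancel-max : ∀ {k} xs ys → All (_< k) ys → (xs ++ [ k ]) ⊖ (ys ++ [ k ]) ≡ xs ⊖ ys
⊖-cancel-max {k} xs ys ys<k = begin
  foldr toggle (ys ++ [ k ]) (xs ++ [ k ])       ≡⟨ foldr-++ toggle (ys ++ [ k ]) xs [ k ] ⟩
  foldr toggle (toggle k (ys ++ [ k ])) xs       ≡⟨ cong (xs ⊖_) (toggle-max ys ys<k) ⟩
  xs ⊖ ys                                        ∎
  where open ≡-Reasoning

⊖-square : ∀ xs ys .{{_ : NonZero (product xs)}} .{{_ : NonZero (product ys)}} →
           IsSquare (product xs) → IsSquare (product ys) → IsSquare (product (xs ⊖ ys))
⊖-square xs ys (r , xs≡r*r) (s , ys≡s*s) with product-⊖ xs ys
... | I , eq = square-cancel _ I {{I≢0}} (r * s , (begin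
  product (xs ⊖ ys) * (I * I)  ≡⟨ eq ⟨
  product xs * product ys      ≡⟨ cong₂ _*_ xs≡r*r ys≡s*s ⟩
  r * r * (s * s)              ≡⟨ solve 2 (λ r s → r :* r :* (s :* s) := r :* s :* (r :* s)) refl r s ⟩
  r * s * (r * s)              ∎))
  where
  open ≡-Reasoning
  I≢0 : NonZero I
  I≢0 = square-factor-nonZero (product (xs ⊖ ys)) I {{m*n≢0 _ _}} eq

linked-product-nonZero : ∀ {x xs} → 0 < x → Linked _<_ (x ∷ xs) → NonZero (product (x ∷ xs))
linked-product-nonZero 0<x l = product≢0 (All.map >-nonZero (Linked⇒All <-trans 0<x l))

linked-init-last : ∀ {x xs k} → Linked _<_ (x ∷ xs) → last (x ∷ xs) ≡ just k →
                   ∃ λ ys → x ∷ xs ≡ ys ++ [ k ] × All (_< k) ys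
linked-init-last {xs = []} _ refl = [] , refl , []
linked-init-last {x} {_ ∷ _} (x<y ∷ l) eq with linked-init-last l eq
... | [] , refl , [] = x ∷ [] , refl , x<y ∷ []
... | y ∷ ys , refl , y<k ∷ ys<k = x ∷ y ∷ ys , refl , <-trans x<y y<k ∷ y<k ∷ ys<k

last-all : ∀ {p} {P : Pred ℕ p} x xs → All P (x ∷ xs) → ∃ λ k → last (x ∷ xs) ≡ just k × P k
last-all x [] (px ∷ []) = x , refl , px
last-all x (y ∷ ys) (_ ∷ pys) = last-all y ys pys

⊖-below-last : ∀ {x xs y ys k} → Linked _<_ (x ∷ xs) → last (x ∷ xs) ≡ just k →
               Linked _<_ (y ∷ ys) → last (y ∷ ys) ≡ just k → All (_< k) ((x ∷ xs) ⊖ (y ∷ ys))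
⊖-below-last {x} {xs} {y} {ys} {k} lx ex ly ey with linked-init-last lx ex | linked-init-last ly ey
... | A′ , A≡A′k , A′<k | B′ , B≡B′k , B′<k = subst (All (_< k)) A′⊖B′≡ (⊖-all A′<k B′<k)
  where
  open ≡-Reasoning
  A′⊖B′≡ : A′ ⊖ B′ ≡ (x ∷ xs) ⊖ (y ∷ ys)
  A′⊖B′≡ = begin
    A′ ⊖ B′                        ≡⟨ ⊖-cancel-max A′ B′ B′<k ⟨
    (A′ ++ [ k ]) ⊖ (B′ ++ [ k ])  ≡⟨ cong₂ _⊖_ A≡A′k B≡B′k ⟨
    (x ∷ xs) ⊖ (y ∷ ys)            ∎

admissible-0 : Admissible 0 0
admissible-0 = [] , [-] , refl , 0 , refl

admissible-≤ : ∀ {n k} → Admissible n k → n ≤ k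
admissible-≤ (_ , l , eq , _) with linked-init-last l eq
... | [] , refl , [] = ≤-refl
... | _ ∷ _ , refl , n<k ∷ _ = <⇒≤ n<k

admissible-descent : ∀ {m n k} → 0 < m → m < n → Admissible m k → Admissible n k →
                     ∃ λ k′ → k′ < k × Admissible m k′
admissible-descent {m} {n} {k} 0<m m<n (as , la , lastA , □A) (bs , lb , lastB , □B) =
  let k′ , last≡k′ , k′<k = last-all m rest m∷rest<k in
  k′ , k′<k , rest , ⊖-linked as (n ∷ bs) la (m<n ∷ lb) , last≡k′ ,
  subst (λ xs → IsSquare (product xs)) A⊖B≡m∷rest (⊖-square (m ∷ as) (n ∷ bs) □A □B)
  where
  instance
    A≢0 : NonZero (product (m ∷ as))
    A≢0 = linked-product-nonZero 0<m la
    B≢0 : NonZero (product (n ∷ bs))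
    B≢0 = linked-product-nonZero (<-trans 0<m m<n) lb
  rest = as ⊖ (n ∷ bs)
  A⊖B≡m∷rest : (m ∷ as) ⊖ (n ∷ bs) ≡ m ∷ rest
  A⊖B≡m∷rest = ⊖-head as bs m<n la lb
  m∷rest<k : All (_< k) (m ∷ rest)
  m∷rest<k = subst (All (_< k)) A⊖B≡m∷rest (⊖-below-last la lastA lb lastB)

IsG⇒¬admissible-> : ∀ {m n k} → m < n → IsG m k → ¬ Admissible n k
IsG⇒¬admissible-> {zero} 0<n (_ , least) admₙ = <⇒≱ 0<n (≤-trans (admissible-≤ admₙ) (least 0 admissible-0))
IsG⇒¬admissible-> {suc _} m<n (admₘ , least) admₙ =
  let k′ , k′<k , admₘ′ = admissible-descent z<s m<n admₘ admₙ in <⇒≱ k′<k (least k′ admₘ′)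

theorem1p8 : (m n k : ℕ) → IsG m k → IsG n k → m ≡ n
theorem1p8 m n k gm gn with <-cmp m n
... | tri< m<n _ _ = contradiction (proj₁ gn) (IsG⇒¬admissible-> m<n gm)
... | tri≈ _ m≡n _ = m≡n
... | tri> _ _ n<m = contradiction (proj₁ gm) (IsG⇒¬admissible-> n<m gn)
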